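{- Let $k$ be a positive integer and $S=\langle 4k+5,4k+7,4k+11,4k+13\rangle$. Then \[\mathrm{Ap}(S,4k+5)=\{a(4k+7)+b(4k+11)+c(4k+13)\mid (a,b,c)\in C\},\] where $C=C_a\cup C_b\cup C_c$ with $C_a=\big(\{1\}\times\{0\}\times\{0,1,\dots,k\}\big)\cup\{(2,0,0)\}$, $C_b=\big(\{0\}\times\{1,2\}\times\{0,1,\dots,k\}\big)\setminus\{(0,2,k)\}$, and $C_c=\{0\}\times\{0\}\times\{0,1,\dots,k+1\}$.
   Context: $\mathbb{N}=\{0,1,2,\dots\}$. For $X\subseteq\mathbb{N}$, $\langle X\rangle$ is the submonoid of $(\mathbb{N},+)$ generated by $X$; here it is a numerical semigroup. For a numerical semigroup $S$ and $n\in S\setminus\{0\}$, the Apéry set is $\mathrm{Ap}(S,n)=\{s\in S\mid s-n\notin S\}$. -}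

module Defs where

open import Data.Nat using (ℕ; zero; suc; _+_; _*_; _∸_; _≤_)
open import Data.Product using (_×_; Σ; ∃; _,_)
open import Data.Sum using (_⊎_)
open import Relation.Binary.PropositionalEquality using (_≡_)
open import Relation.Nullary using (¬_)

Pred : Set₁
Pred = ℕ → Set

data ⟨_⟩ (X : Pred) : Pred where
  gen-zero : ⟨ X ⟩ 0
  gen-elem : ∀ {x} → X x → ⟨ X ⟩ x
  gen-add  : ∀ {x y} → ⟨ X ⟩ x → ⟨ X ⟩ y → ⟨ X ⟩ (x + y)

-- Apéry set Ap(S,n) = { s ∈ S | s - n ∉ S }.  Since S ⊆ ℕ, "s - n ∈ S"
-- means: n ≤ s and the natural number s ∸ n lies in S.
Ap : Pred → ℕ → Pred
Ap S n s = S s × ¬ (n ≤ s × S (s ∸ n))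

Gens : ℕ → Pred
Gens k x = (x ≡ 4 * k + 5) ⊎ (x ≡ 4 * k + 7) ⊎ (x ≡ 4 * k + 11) ⊎ (x ≡ 4 * k + 13)

C-a : ℕ → ℕ → ℕ → ℕ → Set
C-a k a b c = (a ≡ 1 × b ≡ 0 × c ≤ k) ⊎ (a ≡ 2 × b ≡ 0 × c ≡ 0)

C-b : ℕ → ℕ → ℕ → ℕ → Set
C-b k a b c = (a ≡ 0 × (b ≡ 1 ⊎ b ≡ 2) × c ≤ k) × ¬ (a ≡ 0 × b ≡ 2 × c ≡ k)

C-c : ℕ → ℕ → ℕ → ℕ → Set
C-c k a b c = a ≡ 0 × b ≡ 0 × c ≤ k + 1

C : ℕ → ℕ → ℕ → ℕ → Set
C k a b c = C-a k a b c ⊎ C-b k a b c ⊎ C-c k a b c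

{-# OPTIONS --safe #-}
-- With n = 4k+5 the generators are n + 2e for e ∈ {0,1,3,4}, so every element of S can be written
-- t·n + 2j with j < n, trading an excess 2n in the offset j for two more copies of n; since n is odd,
-- this normal form is unique.  Such an element lies in Ap(S,n) exactly when no fewer than t offsets
-- from {0,1,3,4} sum to j, and the triples in C, counting the offsets 1, 3 and 4 used, are precisely
-- these shortest representations of the offsets 0 ≤ j < n.
module Submission where

open import Defs
open import Data.Fin using (Fin; zero; suc; toℕ)
open import Data.Nat using (ℕ; zero; suc; _+_; _*_; _∸_; _≤_; _<_; z≤n; s≤s; _<?_)
open import Data.Nat.DivMod using (module DivMod; _divMod_)
open import Data.Nat.Divisibility using (_∣_; divides; ∣m+n∣m⇒∣n)
open import Data.Nat.Properties
open import Data.Nat.Tactic.RingSolver using (solve-∀)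
open import Data.Product using (Σ; _×_; _,_; proj₁; proj₂; map₁)
open import Data.Sum using (inj₁; inj₂)
open import Data.Empty using (⊥)
open import Function.Bundles using (_⇔_; mk⇔)
open import Relation.Binary.PropositionalEquality
open import Relation.Nullary using (¬_; yes; no; contradiction)

n+y∉Ap : ∀ {S : Pred} {n x y} → S y → x ≡ n + y → ¬ Ap S n x
n+y∉Ap {S} {n} {y = y} y∈S refl (_ , ¬n+S) =
  ¬n+S (m≤m+n n y , subst S (sym (m+n∸m≡n n y)) y∈S)

even≢[1+t]*odd+even : ∀ {n j} t j′ → ¬ 2 ∣ n → j < n → 2 * j ≢ suc t * n + 2 * j′
even≢[1+t]*odd+even {n} {j} zero j′ n-odd _ eq =
  n-odd (∣m+n∣m⇒∣n (subst (2 ∣_) [2j′+n] (divides j (*-comm 2 j))) (divides j′ (*-comm 2 j′)))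
  where
    [2j′+n] : 2 * j ≡ 2 * j′ + n
    [2j′+n] = trans eq (trans (cong (_+ 2 * j′) (+-identityʳ n)) (+-comm n (2 * j′)))
even≢[1+t]*odd+even {n} {j} (suc t) j′ _ j<n =
  <⇒≢ (<-≤-trans (*-monoʳ-< 2 j<n)
                 (≤-trans (*-monoˡ-≤ n (s≤s (s≤s (z≤n {t})))) (m≤m+n (suc (suc t) * n) (2 * j′))))

odd-normal-form-unique : ∀ {n} t t′ {j j′} → ¬ 2 ∣ n → j < n → j′ < n →
  t * n + 2 * j ≡ t′ * n + 2 * j′ → t ≡ t′ × j ≡ j′
odd-normal-form-unique zero zero _ _ _ eq = refl , *-cancelˡ-≡ _ _ 2 eq
odd-normal-form-unique zero (suc t′) {j′ = j′} n-odd j<n _ eq =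
  contradiction eq (even≢[1+t]*odd+even t′ j′ n-odd j<n)
odd-normal-form-unique (suc t) zero {j} n-odd _ j′<n eq =
  contradiction (sym eq) (even≢[1+t]*odd+even t j n-odd j′<n)
odd-normal-form-unique {n} (suc t) (suc t′) {j} {j′} n-odd j<n j′<n eq =
  map₁ (cong suc) (odd-normal-form-unique t t′ n-odd j<n j′<n (+-cancelˡ-≡ n _ _ n+eq))
  where
    n+eq : n + (t * n + 2 * j) ≡ n + (t′ * n + 2 * j′)
    n+eq = trans (sym (+-assoc n (t * n) (2 * j))) (trans eq (+-assoc n (t′ * n) (2 * j′)))

-- Necessary conditions for j to be a sum of t offsets from {0,1,3,4}; they survive the carry.
Admissible : ℕ → ℕ → Set
Admissible t j = j ≤ 4 * t × (j ≡ 2 → 2 ≤ t)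

admissible-+ : ∀ {t₁ t₂ j₁ j₂} → Admissible t₁ j₁ → Admissible t₂ j₂ → Admissible (t₁ + t₂) (j₁ + j₂)
admissible-+ {t₁} {t₂} {j₁} {j₂} (j₁≤4t₁ , two₁) (j₂≤4t₂ , two₂) =
  subst (j₁ + j₂ ≤_) (sym (*-distribˡ-+ 4 t₁ t₂)) (+-mono-≤ j₁≤4t₁ j₂≤4t₂) ,
  two j₁ j₂ t₁ t₂ j₁≤4t₁ j₂≤4t₂ two₁ two₂
  where
    two : ∀ j₁ j₂ t₁ t₂ → j₁ ≤ 4 * t₁ → j₂ ≤ 4 * t₂ → (j₁ ≡ 2 → 2 ≤ t₁) → (j₂ ≡ 2 → 2 ≤ t₂) →
      j₁ + j₂ ≡ 2 → 2 ≤ t₁ + t₂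
    two zero _ t₁ t₂ _ _ _ two₂ eq = ≤-trans (two₂ eq) (m≤n+m t₂ t₁)
    two 1 zero _ _ _ _ _ _ ()
    two 1 1 zero _ () _ _ _ _
    two 1 1 (suc _) zero _ () _ _ _
    two 1 1 (suc t₁) (suc t₂) _ _ _ _ _ = s≤s (≤-trans (s≤s z≤n) (m≤n+m (suc t₂) t₁))
    two 1 (suc (suc _)) _ _ _ _ _ _ ()
    two 2 _ t₁ t₂ _ _ two₁ _ _ = ≤-trans (two₁ refl) (m≤m+n t₁ t₂)
    two (suc (suc (suc _))) _ _ _ _ _ _ _ ()

admissible-+2 : ∀ {t j j′} → Admissible t j → j′ ≤ j → Admissible (t + 2) j′
admissible-+2 {t} (j≤4t , _) j′≤j = ≤-trans j′≤j (≤-trans j≤4t (*-monoʳ-≤ 4 (m≤m+n t 2))) , λ _ → m≤n+m 2 t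

normal-+-normal : ∀ n t₁ t₂ j₁ j₂ → (t₁ * n + 2 * j₁) + (t₂ * n + 2 * j₂) ≡ (t₁ + t₂) * n + 2 * (j₁ + j₂)
normal-+-normal = solve-∀

normal-carry : ∀ n t j → t * n + 2 * (n + j) ≡ (t + 2) * n + 2 * j
normal-carry = solve-∀

normal-shift : ∀ n s d j → (suc s + d) * n + 2 * j ≡ n + (d * n + (s * n + 2 * j))
normal-shift = solve-∀

multiple∈⟨⟩ : ∀ {X : Pred} m {g} → X g → ⟨ X ⟩ (m * g)
multiple∈⟨⟩ zero _ = gen-zero
multiple∈⟨⟩ (suc m) g∈X = gen-add (gen-elem g∈X) (multiple∈⟨⟩ m g∈X)

data Residue4 : ℕ → Set where
  residue : ∀ (r : Fin 4) q → Residue4 (toℕ r + 4 * q)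

residue4 : ∀ j → Residue4 j
residue4 j = subst Residue4 (sym (trans property (cong (toℕ remainder +_) (*-comm quotient 4))))
                   (residue remainder quotient)
  where open DivMod (j divMod 4)

r+4*q<4*m⇒q<m : ∀ r {q m} → r + 4 * q < 4 * m → q < m
r+4*q<4*m⇒q<m r {q} {m} lt = *-cancelˡ-< 4 q m (≤-<-trans (m≤n+m (4 * q) r) lt)

r+4*q≤4*[1+m] : ∀ {r q m} → r ≤ 4 → q ≤ m → r + 4 * q ≤ 4 * suc m
r+4*q≤4*[1+m] {r} {q} {m} r≤4 q≤m = subst (r + 4 * q ≤_) (sym (*-suc 4 m)) (+-mono-≤ r≤4 (*-monoʳ-≤ 4 q≤m))

offset : ℕ → ℕ → ℕ → ℕ
offset a b c = a + 3 * b + 4 * c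

size : ℕ → ℕ → ℕ → ℕ
size a b c = a + b + c

offset-0-2 : ∀ c → offset 0 2 c ≡ 2 + 4 * suc c
offset-0-2 = lemma
  where
    lemma : ∀ c → 0 + 3 * 2 + 4 * c ≡ 2 + 4 * (1 + c)
    lemma = solve-∀

C⇒minimal-size : ∀ {k a b c t} → C k a b c → Admissible t (offset a b c) → size a b c ≤ t
C⇒minimal-size (inj₁ (inj₁ (refl , refl , _))) (j≤4t , _) = r+4*q<4*m⇒q<m 0 j≤4t
C⇒minimal-size (inj₁ (inj₂ (refl , refl , refl))) (_ , two) = two refl
C⇒minimal-size (inj₂ (inj₁ ((refl , inj₁ refl , _) , _))) (j≤4t , _) = r+4*q<4*m⇒q<m 2 j≤4t
C⇒minimal-size {c = c} {t} (inj₂ (inj₁ ((refl , inj₂ refl , _) , _))) (j≤4t , _) =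
  r+4*q<4*m⇒q<m 1 (subst (_≤ 4 * t) (offset-0-2 c) j≤4t)
C⇒minimal-size (inj₂ (inj₂ (refl , refl , _))) (j≤4t , _) = *-cancelˡ-≤ 4 j≤4t

C⇒offset≤4[1+k] : ∀ {k a b c} → C k a b c → offset a b c ≤ 4 * suc k
C⇒offset≤4[1+k] (inj₁ (inj₁ (refl , refl , c≤k))) = r+4*q≤4*[1+m] (s≤s z≤n) c≤k
C⇒offset≤4[1+k] (inj₁ (inj₂ (refl , refl , refl))) = r+4*q≤4*[1+m] (s≤s (s≤s z≤n)) z≤n
C⇒offset≤4[1+k] (inj₂ (inj₁ ((refl , inj₁ refl , c≤k) , _))) = r+4*q≤4*[1+m] (s≤s (s≤s (s≤s z≤n))) c≤k
C⇒offset≤4[1+k] {k} {c = c} (inj₂ (inj₁ ((refl , inj₂ refl , c≤k) , ¬c≡k))) =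
  subst (_≤ 4 * suc k) (sym (offset-0-2 c))
        (r+4*q≤4*[1+m] (s≤s (s≤s z≤n)) (≤∧≢⇒< c≤k (λ c≡k → ¬c≡k (refl , refl , c≡k))))
C⇒offset≤4[1+k] {k} {c = c} (inj₂ (inj₂ (refl , refl , c≤k+1))) = *-monoʳ-≤ 4 (subst (c ≤_) (+-comm k 1) c≤k+1)

module _ (k : ℕ) where

  private
    n : ℕ
    n = 4 * k + 5

    n≡1+4[1+k] : n ≡ suc (4 * suc k)
    n≡1+4[1+k] = lemma k
      where
        lemma : ∀ k → 4 * k + 5 ≡ suc (4 * suc k)
        lemma = solve-∀

  n-odd : ¬ 2 ∣ n
  n-odd (divides q n≡q*2) = even≢odd q (2 * k + 2) (trans (*-comm 2 q) (trans (sym n≡q*2) (lemma k)))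
    where
      lemma : ∀ k → 4 * k + 5 ≡ suc (2 * (2 * k + 2))
      lemma = solve-∀

  <n⇒≤4[1+k] : ∀ {j} → j < n → j ≤ 4 * suc k
  <n⇒≤4[1+k] {j} j<n = ≤-pred (subst (j <_) n≡1+4[1+k] j<n)

  ≤4[1+k]⇒<n : ∀ {j} → j ≤ 4 * suc k → j < n
  ≤4[1+k]⇒<n {j} j≤ = subst (j <_) (sym n≡1+4[1+k]) (s≤s j≤)

  value : ℕ → ℕ → ℕ → ℕ
  value a b c = a * (4 * k + 7) + b * (4 * k + 11) + c * (4 * k + 13)

  value≡ : ∀ a b c → value a b c ≡ size a b c * n + 2 * offset a b c
  value≡ = lemma k
    where
      lemma : ∀ k a b c → a * (4 * k + 7) + b * (4 * k + 11) + c * (4 * k + 13) ≡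
                          (a + b + c) * (4 * k + 5) + 2 * (a + 3 * b + 4 * c)
      lemma = solve-∀

  value∈S : ∀ a b c → ⟨ Gens k ⟩ (value a b c)
  value∈S a b c = gen-add (gen-add (multiple∈⟨⟩ a (inj₂ (inj₁ refl))) (multiple∈⟨⟩ b (inj₂ (inj₂ (inj₁ refl)))))
                          (multiple∈⟨⟩ c (inj₂ (inj₂ (inj₂ refl))))

  data Normal (x : ℕ) : Set where
    normal : ∀ t j → j < n → Admissible t j → x ≡ t * n + 2 * j → Normal x

  generator-normal : ∀ {x} e → e ≤ 4 → e ≢ 2 → x ≡ 4 * k + (5 + 2 * e) → Normal x
  generator-normal e e≤4 e≢2 eq =
    normal 1 e (≤-<-trans e≤4 (m≤n+m 5 (4 * k))) (e≤4 , λ e≡2 → contradiction e≡2 e≢2)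
      (trans eq (trans (sym (+-assoc (4 * k) 5 (2 * e))) (cong (_+ 2 * e) (sym (*-identityˡ n)))))

  normal-+ : ∀ {x y} → Normal x → Normal y → Normal (x + y)
  normal-+ (normal t₁ j₁ j₁<n adm₁ refl) (normal t₂ j₂ j₂<n adm₂ refl) with j₁ + j₂ <? n
  ... | yes j<n = normal (t₁ + t₂) (j₁ + j₂) j<n (admissible-+ adm₁ adm₂) (normal-+-normal n t₁ t₂ j₁ j₂)
  ... | no j≮n = normal (t₁ + t₂ + 2) (j₁ + j₂ ∸ n) carry<n
                   (admissible-+2 (admissible-+ adm₁ adm₂) (m∸n≤m (j₁ + j₂) n)) carry-eq
    where
      j = j₁ + j₂
      n+[j∸n]≡j : n + (j ∸ n) ≡ j
      n+[j∸n]≡j = m+[n∸m]≡n (≮⇒≥ j≮n)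
      carry<n : j ∸ n < n
      carry<n = +-cancelˡ-< n (j ∸ n) n (subst (_< n + n) (sym n+[j∸n]≡j) (+-mono-< j₁<n j₂<n))
      carry-eq : (t₁ * n + 2 * j₁) + (t₂ * n + 2 * j₂) ≡ (t₁ + t₂ + 2) * n + 2 * (j ∸ n)
      carry-eq = begin
        (t₁ * n + 2 * j₁) + (t₂ * n + 2 * j₂)  ≡⟨ normal-+-normal n t₁ t₂ j₁ j₂ ⟩
        (t₁ + t₂) * n + 2 * j                  ≡⟨ cong (λ i → (t₁ + t₂) * n + 2 * i) n+[j∸n]≡j ⟨
        (t₁ + t₂) * n + 2 * (n + (j ∸ n))      ≡⟨ normal-carry n (t₁ + t₂) (j ∸ n) ⟩
        (t₁ + t₂ + 2) * n + 2 * (j ∸ n)        ∎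
        where open ≡-Reasoning

  normal-form : ∀ {x} → ⟨ Gens k ⟩ x → Normal x
  normal-form gen-zero = normal 0 0 (≤-<-trans z≤n (m≤n+m 5 (4 * k))) (z≤n , λ ()) refl
  normal-form (gen-elem (inj₁ eq)) = generator-normal 0 z≤n (λ ()) eq
  normal-form (gen-elem (inj₂ (inj₁ eq))) = generator-normal 1 (s≤s z≤n) (λ ()) eq
  normal-form (gen-elem (inj₂ (inj₂ (inj₁ eq)))) = generator-normal 3 (s≤s (s≤s (s≤s z≤n))) (λ ()) eq
  normal-form (gen-elem (inj₂ (inj₂ (inj₂ eq)))) = generator-normal 4 ≤-refl (λ ()) eq
  normal-form (gen-add x∈S y∈S) = normal-+ (normal-form x∈S) (normal-form y∈S)

  decompose : ∀ {t j} → j < n → Admissible t j →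
    Σ ℕ λ a → Σ ℕ λ b → Σ ℕ λ c → C k a b c × j ≡ offset a b c × size a b c ≤ t
  decompose {t} {j} j<n = split (residue4 j) (<n⇒≤4[1+k] j<n)
    where
      split : ∀ {j} → Residue4 j → j ≤ 4 * suc k → Admissible t j →
        Σ ℕ λ a → Σ ℕ λ b → Σ ℕ λ c → C k a b c × j ≡ offset a b c × size a b c ≤ t
      split (residue zero q) j≤ (j≤4t , _) =
        0 , 0 , q , inj₂ (inj₂ (refl , refl , subst (q ≤_) (+-comm 1 k) (*-cancelˡ-≤ 4 j≤))) ,
        refl , *-cancelˡ-≤ 4 j≤4t
      split (residue (suc zero) q) j≤ (j≤4t , _) =
        1 , 0 , q , inj₁ (inj₁ (refl , refl , ≤-pred (r+4*q<4*m⇒q<m 0 j≤))) ,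
        refl , r+4*q<4*m⇒q<m 0 j≤4t
      split (residue (suc (suc zero)) zero) _ (_ , two) =
        2 , 0 , 0 , inj₁ (inj₂ (refl , refl , refl)) , refl , two refl
      split (residue (suc (suc zero)) (suc q)) j≤ (j≤4t , _) =
        0 , 2 , q , inj₂ (inj₁ ((refl , inj₂ refl , <⇒≤ q<k) , λ (_ , _ , q≡k) → <⇒≢ q<k q≡k)) ,
        sym (offset-0-2 q) , r+4*q<4*m⇒q<m 1 j≤4t
        where
          q<k : q < k
          q<k = ≤-pred (r+4*q<4*m⇒q<m 1 j≤)
      split (residue (suc (suc (suc zero))) q) j≤ (j≤4t , _) =
        0 , 1 , q , inj₂ (inj₁ ((refl , inj₁ refl , ≤-pred (r+4*q<4*m⇒q<m 2 j≤)) , λ { (_ , () , _) })) ,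
        refl , r+4*q<4*m⇒q<m 2 j≤4t

  Ap⇒value : ∀ {x} → Ap ⟨ Gens k ⟩ n x →
    Σ ℕ λ a → Σ ℕ λ b → Σ ℕ λ c → C k a b c × x ≡ value a b c
  Ap⇒value x∈Ap@(x∈S , _) with normal-form x∈S
  ... | normal t j j<n adm refl with decompose j<n adm
  ... | a , b , c , abc∈C , refl , size≤t with m≤n⇒m<n∨m≡n size≤t
  ...   | inj₂ refl = a , b , c , abc∈C , sym (value≡ a b c)
  ...   | inj₁ size<t with m≤n⇒∃[o]m+o≡n size<t
  ...     | d , refl =
    contradiction x∈Ap (n+y∉Ap {⟨ Gens k ⟩} (gen-add (multiple∈⟨⟩ d (inj₁ refl)) (value∈S a b c)) x≡n+y)
    where
      x≡n+y : (suc (size a b c) + d) * n + 2 * offset a b c ≡ n + (d * n + value a b c)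
      x≡n+y = begin
        (suc (size a b c) + d) * n + 2 * offset a b c     ≡⟨ normal-shift n (size a b c) d (offset a b c) ⟩
        n + (d * n + (size a b c * n + 2 * offset a b c)) ≡⟨ cong (λ v → n + (d * n + v)) (value≡ a b c) ⟨
        n + (d * n + value a b c)                         ∎
        where open ≡-Reasoning

  value⇒Ap : ∀ {a b c} → C k a b c → Ap ⟨ Gens k ⟩ n (value a b c)
  value⇒Ap {a} {b} {c} abc∈C = value∈S a b c , not-shifted
    where
      no-normal-shift : ∀ {t j} → j < n → Admissible t j → value a b c ≡ suc t * n + 2 * j → ⊥
      no-normal-shift {t} {j} j<n adm v≡ =
        1+n≰n (subst (_≤ t) (proj₁ same) (C⇒minimal-size abc∈C (subst (Admissible t) (sym (proj₂ same)) adm)))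
        where
          same : size a b c ≡ suc t × offset a b c ≡ j
          same = odd-normal-form-unique {n} (size a b c) (suc t) n-odd (≤4[1+k]⇒<n (C⇒offset≤4[1+k] abc∈C)) j<n
                   (trans (sym (value≡ a b c)) v≡)

      not-shifted : ¬ (n ≤ value a b c × ⟨ Gens k ⟩ (value a b c ∸ n))
      not-shifted (n≤v , v∸n∈S) with normal-form v∸n∈S
      ... | normal t j j<n adm v∸n≡ = no-normal-shift j<n adm (begin
        value a b c            ≡⟨ m+[n∸m]≡n n≤v ⟨
        n + (value a b c ∸ n)  ≡⟨ cong (n +_) v∸n≡ ⟩
        n + (t * n + 2 * j)    ≡⟨ +-assoc n (t * n) (2 * j) ⟨
        suc t * n + 2 * j      ∎)
        where open ≡-Reasoning

-- The hypothesis 1 ≤ k is not needed: the description of the Apéry set is also correct for k = 0.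
theorem24 : (k : ℕ) → 1 ≤ k → (x : ℕ) →
    Ap ⟨ Gens k ⟩ (4 * k + 5) x ⇔
    Σ ℕ (λ a → Σ ℕ (λ b → Σ ℕ (λ c →
    C k a b c × x ≡ a * (4 * k + 7) + b * (4 * k + 11) + c * (4 * k + 13))))
theorem24 k _ _ = mk⇔ (Ap⇒value k)
  λ (a , b , c , abc∈C , x≡value) → subst (Ap ⟨ Gens k ⟩ (4 * k + 5)) (sym x≡value) (value⇒Ap k abc∈C)
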